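{- Let $\tau=(w,x)$ be a pair, $p=(i,j)\in X^c_\tau$ and $t=t_{i_1,i_2}\in R_\tau$. Assume that $q=p^\to_{\tau_t}\in X^c_\tau$. Then $q^\leftarrow_\tau=p^\leftarrow_\tau$. Assume moreover that $R^\leftarrow_\tau(q)$ holds. Then $p^\uparrow_\tau=(i',j)$ with $i'<i_1$, and in fact $i'\le i''$ where $q^-_\tau=(i'',j'')$; in particular $p$ is not $\uparrow$-maximal with respect to $\tau$. If in addition $p\in X^c_{(xt,x)}$, then $(i_1,x(i_1))\in(q^-_\tau,p]$ and $P^\uparrow_\tau(p)$ holds.
   Context: $S_n$ is the symmetric group on $\{1,\dots,n\}$ with Bruhat order $\le$; $\Box=\{0,\dots,n\}^2$. For $w\in S_n$, $\mathrm{rk}_w(i,j)=\#\{u\le i:w(u)\le j\}$ on $\Box$, and $D_w((i,j),(i',j'))=\mathrm{rk}_w(i,j)+\mathrm{rk}_w(i',j')-\mathrm{rk}_w(i,j')-\mathrm{rk}_w(i',j)$. For $a=(a_1,a_2),b=(b_1,b_2)\in\Box$, $a<b$ means $a_1<b_1,a_2<b_2$, $a\le b$ means $a_1\le b_1,a_2\le b_2$, and $(a,b]=\{q\in\Box:a<q\le b\}$. A pair is $\sigma=(u,v)$ with $v\le u$; $\mathrm{rk}_\sigma=\mathrm{rk}_v-\mathrm{rk}_u$, $X_\sigma=\{p\in\Box:\mathrm{rk}_\sigma(p)=0\}$, $X^c_\sigma=\Box\setminus X_\sigma$. For $\tau=(w,x)$, $R_\tau=\{t\text{ transposition}:x<xt\le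 w\}$, $t_{i_1,i_2}$ ($i_1<i_2$) is a transposition, and for $t\in R_\tau$, $\tau_t=(w,xt)$ and $(xt,x)$ are pairs. For a pair $\sigma=(u,v)$ and $p=(i,j)\in\Box$ with $1\le j\le n-1$: $p^\to_\sigma=(i,\min\{k>j:(i,k)\in X_\sigma\})$; $j^-=\max\{k<j:(i,k)\in X_\sigma\}$, $p^\leftarrow_\sigma=(i,j^-)$, $i^-=\min\{l\le i:(l,j^-)\in X_\sigma,\ D_u(p,(l,j^-))=0\}$, $p^\uparrow_\sigma=(i^-,j)$; $p$ is $\uparrow$-maximal if $p^\uparrow_\sigma=p$; $P^\uparrow_\sigma(p)$ means $\mathrm{rk}_\sigma(p^\uparrow_\sigma)<\mathrm{rk}_\sigma(p)$. For $p=(i,j)\in X^c_\sigma$: $p^-_\sigma=(\max\{l<i:(l,j)\in X_\sigma\},\max\{l<j:(i,l)\in X_\sigma\})$, and $R^\leftarrow_\sigma(p)$ means $D_v(p,p^-_\sigma)=1$. -}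

module Defs where

open import Data.Nat using (ℕ; zero; suc; _≤_; _<_; _∸_)
open import Data.Nat.Properties using (_<?_)
open import Data.Bool using (Bool; true; false; if_then_else_; _∧_)
open import Data.Fin using (Fin; toℕ)
open import Data.Fin.Permutation using (Permutation′; _⟨$⟩ʳ_; _≈_; transpose; _∘ₚ_)
open import Data.Integer using (ℤ; +_; _-_; _+_)
import Data.Integer as ℤ
open import Data.Product using (_×_; _,_; proj₁; proj₂)
open import Relation.Nullary using (¬_)
open import Relation.Nullary.Decidable using (⌊_⌋)
open import Relation.Binary.PropositionalEquality using (_≡_)

-- Permutations of {1,…,n} are represented by Permutation′ n on Fin n;
-- the element k ∈ {1,…,n} corresponds to the Fin n element with toℕ = k - 1.

countFin : ∀ {n} → (Fin n → Bool) → ℕ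
countFin {zero}  P = 0
countFin {suc n} P = (if P Fin.zero then 1 else 0) Data.Nat.+ countFin {n} (λ k → P (Fin.suc k))

-- rk_w(i,j) = #{u ≤ i : w(u) ≤ j}   (u, w(u) 1-based, i.e. toℕ u + 1 ≤ i)
rk : ∀ {n} → Permutation′ n → ℕ → ℕ → ℕ
rk w i j = countFin (λ u → ⌊ toℕ u <? i ⌋ ∧ ⌊ toℕ (w ⟨$⟩ʳ u) <? j ⌋)

Point : Set
Point = ℕ × ℕ

InBox : ℕ → Point → Set
InBox n (i , j) = i ≤ n × j ≤ n

D : ∀ {n} → Permutation′ n → Point → Point → ℤ
D w (i , j) (i' , j') = ((+ rk w i j) + (+ rk w i' j')) - (+ rk w i j') - (+ rk w i' j)

-- Bruhat order via the rank (tableau) criterion: v ≤ u iff rk_v ≥ rk_u on □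
_≤B_ : ∀ {n} → Permutation′ n → Permutation′ n → Set
_≤B_ {n} v u = ∀ i j → i ≤ n → j ≤ n → rk u i j ≤ rk v i j

_<B_ : ∀ {n} → Permutation′ n → Permutation′ n → Set
v <B u = v ≤B u × ¬ (v ≈ u)

-- right multiplication by the transposition t_{i1,i2}: (x t)(k) = x(t(k))
_·t[_,_] : ∀ {n} → Permutation′ n → Fin n → Fin n → Permutation′ n
x ·t[ i₁ , i₂ ] = transpose i₁ i₂ ∘ₚ x

-- For a pair σ = (u , v) (with v ≤ u), rk_σ = rk_v - rk_u
rkσ : ∀ {n} → Permutation′ n → Permutation′ n → Point → ℤ
rkσ u v (i , j) = (+ rk v i j) - (+ rk u i j)

InX : ∀ {n} → Permutation′ n → Permutation′ n → Point → Set
InX u v p = rkσ u v p ≡ + 0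

InXc : ∀ {n} → Permutation′ n → Permutation′ n → Point → Set
InXc {n} u v p = InBox n p × ¬ InX u v p

inXb : ∀ {n} → Permutation′ n → Permutation′ n → Point → Bool
inXb u v p = ⌊ rkσ u v p ℤ.≟ + 0 ⌋

-- max{k < j : P k}  (0 if none)
maxBelow : (ℕ → Bool) → ℕ → ℕ
maxBelow P zero    = 0
maxBelow P (suc j) = if P j then j else maxBelow P j

-- min{k' : k ≤ k' ≤ k + m, P k'}  (k + m if none)
firstFrom : (ℕ → Bool) → ℕ → ℕ → ℕ
firstFrom P k zero    = k
firstFrom P k (suc m) = if P k then k else firstFrom P (suc k) m

-- p^→_σ = (i, min{k > j : (i,k) ∈ X_σ})   (k ranges over j < k ≤ n)
right : ∀ {n} → Permutation′ n → Permutation′ n → Point → Point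
right {n} u v (i , j) = i , firstFrom (λ k → inXb u v (i , k)) (suc j) (n ∸ suc j)

jminus : ∀ {n} → Permutation′ n → Permutation′ n → Point → ℕ
jminus u v (i , j) = maxBelow (λ k → inXb u v (i , k)) j

left : ∀ {n} → Permutation′ n → Permutation′ n → Point → Point
left u v (i , j) = i , jminus u v (i , j)

-- i^- = min{l ≤ i : (l,j^-) ∈ X_σ, D_u(p,(l,j^-)) = 0};  p^↑_σ = (i^-, j)
up : ∀ {n} → Permutation′ n → Permutation′ n → Point → Point
up u v (i , j) =
  firstFrom (λ l → inXb u v (l , jm) ∧ ⌊ D u (i , j) (l , jm) ℤ.≟ + 0 ⌋) 0 i , j
  where jm = jminus u v (i , j)

UpMaximal : ∀ {n} → Permutation′ n → Permutation′ n → Point → Set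
UpMaximal u v p = up u v p ≡ p

Pup : ∀ {n} → Permutation′ n → Permutation′ n → Point → Set
Pup u v p = rkσ u v (up u v p) ℤ.< rkσ u v p

pminus : ∀ {n} → Permutation′ n → Permutation′ n → Point → Point
pminus u v (i , j) = maxBelow (λ l → inXb u v (l , j)) i , maxBelow (λ l → inXb u v (i , l)) j

Rleft : ∀ {n} → Permutation′ n → Permutation′ n → Point → Set
Rleft u v p = D v p (pminus u v p) ≡ + 1

InHalfOpen : ℕ → Point → Point → Point → Set
InHalfOpen n (a₁ , a₂) (b₁ , b₂) (q₁ , q₂) =
  InBox n (q₁ , q₂) × (a₁ < q₁ × a₂ < q₂) × (q₁ ≤ b₁ × q₂ ≤ b₂)

module Submission where

-- Right multiplication by t changes the rank function only on the rectangle
-- (i₁, i₂] × (x(i₁), x(i₂)], where it drops by exactly one (module Transposition).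
-- Consequently X_τ ⊆ X_{τ_t}, the rectangle misses X_τ, and X^c_{(xt,x)} lies inside it.
-- As q ∈ X_{τ_t} \ X_τ, q lies in the rectangle and no point of row i in [j, k) is in X_τ,
-- which gives q^←_τ = p^←_τ.  Next, D_w(p, p') counts the points of w in the box spanned by
-- p' and p (rk-box).  With it, R^←_τ(q) says that q^-_τ = (i″, j^-) ∈ X_τ and w has no point
-- in the box spanned by q^-_τ and q (unit-defect); so D_w(p, (i″, j^-)) = 0 and i″ is a
-- candidate in the search defining p^↑_τ = (i′, j), whence i′ ≤ i″ ≤ i₁ < i.  Finally, if
-- p ∉ X_{(xt,x)} then p lies in the rectangle too, the point (i₁, x(i₁)) of x lies in the box
-- spanned by (i′, j^-) and p, and this makes rk_τ drop from p to p^↑_τ (rkσ-drop).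

open import Defs
open import Data.Nat using (ℕ; zero; suc; _+_; _∸_; _≤_; _<_; z≤n; s≤s; _<?_; _≟_; _≤?_)
open import Data.Nat.Properties
  using ( ≤-refl; ≤-reflexive; ≤-trans; ≤-antisym; <-irrefl; <-trans; ≤-<-trans; <⇒≤; <⇒≱; ≤⇒≯
        ; ≮⇒≥; ≰⇒>; ≤∧≢⇒<; n≤1+n; m≤n⇒m≤1+n; m≤m+n; n≤0⇒n≡0; 1+n≢n; suc-injective
        ; +-assoc; +-identityʳ; +-suc; m+[n∸m]≡n; +-mono-≤; +-monoˡ-<; +-monoʳ-<
        ; +-cancelˡ-≤; +-cancelʳ-≤; +-cancelˡ-≡; +-0-commutativeMonoid; module ≤-Reasoning )
open import Data.Bool using (Bool; true; false; if_then_else_; _∧_; not; T)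
open import Data.Bool.Properties using (T-≡; T-∧; ∧-zeroʳ; ∧-identityʳ)
open import Data.Fin using (Fin; toℕ; punchIn)
import Data.Fin as Fin
open import Data.Fin.Properties using (punchInᵢ≢i; toℕ<n)
open import Data.Fin.Permutation using (Permutation′; _⟨$⟩ʳ_)
import Data.Fin.Permutation.Components as PC
open import Data.Product using (_×_; _,_; proj₁; proj₂)
open import Data.Sum using (_⊎_; inj₁; inj₂)
open import Data.Empty using (⊥-elim)
open import Data.Unit using (tt)
import Data.Integer as ℤ
import Data.Integer.Properties as ℤ
open import Function using (_∘_)
open import Function.Bundles using (Equivalence)
open import Relation.Nullary using (¬_; yes; no; does)
open import Relation.Nullary.Decidable
  using (⌊_⌋; dec-true; dec-false; toWitness; fromWitness; toWitnessFalse; fromWitnessFalse)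
open import Relation.Binary.PropositionalEquality
open import Algebra.Properties.CommutativeMonoid.Sum +-0-commutativeMonoid
  using (sum; sum-cong-≗; sum-remove; ∑-distrib-+)
import Data.Nat.Tactic.RingSolver as ℕ-Solver
import Data.Integer.Tactic.RingSolver as ℤ-Solver

ind : Bool → ℕ
ind b = if b then 1 else 0

countFin≡sum : ∀ {n} (P : Fin n → Bool) → countFin P ≡ sum (ind ∘ P)
countFin≡sum {zero}  P = refl
countFin≡sum {suc n} P = cong (ind (P Fin.zero) +_) (countFin≡sum (P ∘ Fin.suc))

count-cong : ∀ {n} {P Q : Fin n → Bool} → (∀ u → P u ≡ Q u) → countFin P ≡ countFin Q
count-cong {P = P} {Q} P≗Q =
  trans (countFin≡sum P) (trans (sum-cong-≗ (cong ind ∘ P≗Q)) (sym (countFin≡sum Q)))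

count-false : ∀ n → countFin {n} (λ _ → false) ≡ 0
count-false zero    = refl
count-false (suc n) = count-false n

count-linear : ∀ {n} (f g h d e : Fin n → Bool) →
  (∀ u → ind (f u) + ind (g u) + ind (h u) ≡ ind (d u) + ind (e u)) →
  countFin f + countFin g + countFin h ≡ countFin d + countFin e
count-linear f g h d e pointwise = begin
  countFin f + countFin g + countFin h
    ≡⟨ cong₂ (λ a b → a + b + _) (countFin≡sum f) (countFin≡sum g) ⟩
  sum (ind ∘ f) + sum (ind ∘ g) + countFin h
    ≡⟨ cong₂ _+_ (sym (∑-distrib-+ (ind ∘ f) (ind ∘ g))) (countFin≡sum h) ⟩
  sum (λ u → ind (f u) + ind (g u)) + sum (ind ∘ h)
    ≡⟨ sym (∑-distrib-+ _ (ind ∘ h)) ⟩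
  sum (λ u → ind (f u) + ind (g u) + ind (h u))
    ≡⟨ sum-cong-≗ pointwise ⟩
  sum (λ u → ind (d u) + ind (e u))
    ≡⟨ ∑-distrib-+ (ind ∘ d) (ind ∘ e) ⟩
  sum (ind ∘ d) + sum (ind ∘ e)
    ≡⟨ sym (cong₂ _+_ (countFin≡sum d) (countFin≡sum e)) ⟩
  countFin d + countFin e ∎
  where open ≡-Reasoning

count-split : ∀ {n} (P : Fin (suc n) → Bool) (k : Fin (suc n)) →
  countFin P ≡ ind (P k) + sum (ind ∘ P ∘ punchIn k)
count-split P k = trans (countFin≡sum P) (sum-remove {i = k} (ind ∘ P))

count-update : ∀ {n} (P Q : Fin n → Bool) (k : Fin n) → (∀ u → u ≢ k → P u ≡ Q u) →
  ind (Q k) + countFin P ≡ ind (P k) + countFin Q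
count-update {suc n} P Q k agree = begin
  ind (Q k) + countFin P                      ≡⟨ cong (ind (Q k) +_) (count-split P k) ⟩
  ind (Q k) + (ind (P k) + sum (ind ∘ P ∘ punchIn k)) ≡⟨ cong (λ s → ind (Q k) + (ind (P k) + s)) rest ⟩
  ind (Q k) + (ind (P k) + sum (ind ∘ Q ∘ punchIn k)) ≡⟨ swap (ind (Q k)) (ind (P k)) _ ⟩
  ind (P k) + (ind (Q k) + sum (ind ∘ Q ∘ punchIn k)) ≡⟨ cong (ind (P k) +_) (count-split Q k) ⟨
  ind (P k) + countFin Q ∎
  where
  open ≡-Reasoning
  rest : sum (ind ∘ P ∘ punchIn k) ≡ sum (ind ∘ Q ∘ punchIn k)
  rest = sum-cong-≗ (λ v → cong ind (agree (punchIn k v) (punchInᵢ≢i k v)))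
  swap : ∀ a b c → a + (b + c) ≡ b + (a + c)
  swap = ℕ-Solver.solve-∀

count-pos : ∀ {n} (P : Fin n → Bool) (k : Fin n) → T (P k) → 1 ≤ countFin P
count-pos {suc n} P k Pk =
  ≤-trans (ind-true (P k) Pk) (≤-trans (m≤m+n _ _) (≤-reflexive (sym (count-split P k))))
  where
  ind-true : ∀ b → T b → 1 ≤ ind b
  ind-true true _ = ≤-refl

count-mono : ∀ {n} (P Q : Fin n → Bool) → (∀ u → T (P u) → T (Q u)) → countFin P ≤ countFin Q
count-mono {zero}  P Q imp = z≤n
count-mono {suc n} P Q imp = +-mono-≤ (ind-mono (P Fin.zero) (Q Fin.zero) (imp Fin.zero))
  (count-mono (P ∘ Fin.suc) (Q ∘ Fin.suc) (imp ∘ Fin.suc))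
  where
  ind-mono : ∀ a b → (T a → T b) → ind a ≤ ind b
  ind-mono false b _ = z≤n
  ind-mono true true _ = s≤s z≤n
  ind-mono true false imp = ⊥-elim (imp tt)

count-update₂ : ∀ {n} (P Q : Fin n → Bool) (a b : Fin n) → a ≢ b →
  (∀ u → u ≢ a → u ≢ b → P u ≡ Q u) →
  ind (Q a) + ind (Q b) + countFin P ≡ ind (P a) + ind (P b) + countFin Q
count-update₂ P Q a b a≢b agree = begin
  ind (Q a) + ind (Q b) + countFin P    ≡⟨ rearrange (ind (Q a)) (ind (Q b)) _ ⟩
  ind (Q b) + (ind (Q a) + countFin P)  ≡⟨ cong (ind (Q b) +_) update-a ⟩
  ind (Q b) + (ind (P a) + countFin M)  ≡⟨ rearrange′ (ind (Q b)) (ind (P a)) _ ⟩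
  ind (P a) + (ind (Q b) + countFin M)  ≡⟨ cong (ind (P a) +_) update-b ⟩
  ind (P a) + (ind (P b) + countFin Q)  ≡⟨ +-assoc (ind (P a)) (ind (P b)) _ ⟨
  ind (P a) + ind (P b) + countFin Q    ∎
  where
  open ≡-Reasoning
  -- P with its value at a replaced by that of Q: it differs from P only at a,
  -- and from Q only at b.
  M : _ → Bool
  M u = if does (u Fin.≟ a) then Q u else P u
  M-at-a : M a ≡ Q a
  M-at-a rewrite dec-true (a Fin.≟ a) refl = refl
  M-at-b : M b ≡ P b
  M-at-b rewrite dec-false (b Fin.≟ a) (a≢b ∘ sym) = refl
  P≈M : ∀ u → u ≢ a → P u ≡ M u
  P≈M u u≢a rewrite dec-false (u Fin.≟ a) u≢a = refl
  M≈Q : ∀ u → u ≢ b → M u ≡ Q u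
  M≈Q u u≢b with u Fin.≟ a
  ... | yes _   = refl
  ... | no u≢a  = agree u u≢a u≢b
  update-a : ind (Q a) + countFin P ≡ ind (P a) + countFin M
  update-a = subst (λ c → ind c + countFin P ≡ ind (P a) + countFin M) M-at-a (count-update P M a P≈M)
  update-b : ind (Q b) + countFin M ≡ ind (P b) + countFin Q
  update-b = subst (λ c → ind (Q b) + countFin M ≡ ind c + countFin Q) M-at-b (count-update M Q b M≈Q)
  rearrange : ∀ p q r → p + q + r ≡ q + (p + r)
  rearrange = ℕ-Solver.solve-∀
  rearrange′ : ∀ p q r → p + (q + r) ≡ q + (p + r)
  rearrange′ = ℕ-Solver.solve-∀

<?-mono : ∀ {b b'} c → b ≤ b' → T ⌊ c <? b ⌋ → T ⌊ c <? b' ⌋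
<?-mono {b} {b'} c b≤b' h = fromWitness (≤-trans (toWitness {a? = c <? b} h) b≤b')

inRange : ℕ → ℕ → ℕ → Bool
inRange a b c = ⌊ c <? b ⌋ ∧ not ⌊ c <? a ⌋

inRange-intro : ∀ {a b c} → a ≤ c → c < b → T (inRange a b c)
inRange-intro {a} {b} {c} a≤c c<b with c <? b | c <? a
... | yes _   | no _    = tt
... | no c≮b  | _       = c≮b c<b
... | yes _   | yes c<a = <⇒≱ c<a a≤c

inRange-widen : ∀ {a b b'} c → b ≤ b' → T (inRange a b c) → T (inRange a b' c)
inRange-widen {a} {b} {b'} c b≤b' h with c <? b | c <? b' | c <? a
... | yes _   | yes _   | no _ = tt
... | yes c<b | no c≮b' | no _ = c≮b' (≤-trans c<b b≤b')

rk-row₀ : ∀ {n} (w : Permutation′ n) m → rk w 0 m ≡ 0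
rk-row₀ {n} w m = count-false n

rk-col₀ : ∀ {n} (w : Permutation′ n) l → rk w l 0 ≡ 0
rk-col₀ {n} w l = trans (count-cong {n} (λ u → ∧-zeroʳ ⌊ toℕ u <? l ⌋)) (count-false n)

rk-colₙ : ∀ {n} (w v : Permutation′ n) l → rk w l n ≡ rk v l n
rk-colₙ {n} w v l = trans (count-cong (full w)) (sym (count-cong (full v)))
  where
  full : ∀ y u → ⌊ toℕ u <? l ⌋ ∧ ⌊ toℕ (y ⟨$⟩ʳ u) <? n ⌋ ≡ ⌊ toℕ u <? l ⌋
  full y u = trans (cong (⌊ toℕ u <? l ⌋ ∧_) (Equivalence.to T-≡ (fromWitness (toℕ<n (y ⟨$⟩ʳ u)))))
                   (∧-identityʳ _)

-- The number of points (u, w u) of w with i' ≤ u < i and j' ≤ w u < j (0-based),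
-- i.e. the points of w in the box (i',i] × (j',j] of the grid.
boxCount : ∀ {n} → Permutation′ n → Point → Point → ℕ
boxCount w (i' , j') (i , j) = countFin (λ u → inRange i' i (toℕ u) ∧ inRange j' j (toℕ (w ⟨$⟩ʳ u)))

boxCount-mono : ∀ {n} (w : Permutation′ n) {i i' j j' k} → j ≤ k →
  boxCount w (i' , j') (i , j) ≤ boxCount w (i' , j') (i , k)
boxCount-mono w {i} {i'} {j} {j'} {k} j≤k =
  count-mono (λ u → inRange i' i (toℕ u) ∧ inRange j' j (toℕ (w ⟨$⟩ʳ u)))
             (λ u → inRange i' i (toℕ u) ∧ inRange j' k (toℕ (w ⟨$⟩ʳ u)))
             (λ u → ∧-monoʳ (inRange i' i (toℕ u)) (inRange-widen (toℕ (w ⟨$⟩ʳ u)) j≤k))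
  where
  ∧-monoʳ : ∀ a {b c} → (T b → T c) → T (a ∧ b) → T (a ∧ c)
  ∧-monoʳ true b⇒c = b⇒c

boxCount-pos : ∀ {n} (w : Permutation′ n) (u : Fin n) {i i' j j'} →
  i' ≤ toℕ u → toℕ u < i → j' ≤ toℕ (w ⟨$⟩ʳ u) → toℕ (w ⟨$⟩ʳ u) < j → 1 ≤ boxCount w (i' , j') (i , j)
boxCount-pos w u {i} {i'} {j} {j'} i'≤u u<i j'≤wu wu<j =
  count-pos (λ v → inRange i' i (toℕ v) ∧ inRange j' j (toℕ (w ⟨$⟩ʳ v))) u
    (Equivalence.from T-∧ (inRange-intro i'≤u u<i , inRange-intro j'≤wu wu<j))

-- The indicator form of inclusion–exclusion for a box.
box-indicator : (A A' B B' : Bool) → (T A' → T A) → (T B' → T B) →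
  ind (A ∧ B') + ind (A' ∧ B) + ind ((A ∧ not A') ∧ (B ∧ not B')) ≡ ind (A ∧ B) + ind (A' ∧ B')
box-indicator false true  _     _     A'⇒A _    = ⊥-elim (A'⇒A tt)
box-indicator _     _     false true  _    B'⇒B = ⊥-elim (B'⇒B tt)
box-indicator false false _     _     _    _    = refl
box-indicator true  true  true  true  _    _    = refl
box-indicator true  true  true  false _    _    = refl
box-indicator true  true  false false _    _    = refl
box-indicator true  false true  true  _    _    = refl
box-indicator true  false true  false _    _    = refl
box-indicator true  false false false _    _    = refl

-- D_w((i,j),(i',j')) counts the points of w in the box (i',i] × (j',j].
rk-box : ∀ {n} (w : Permutation′ n) {i i' j j'} → i' ≤ i → j' ≤ j →
  rk w i j' + rk w i' j + boxCount w (i' , j') (i , j) ≡ rk w i j + rk w i' j'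
rk-box w {i} {i'} {j} {j'} i'≤i j'≤j = count-linear _ _ _ _ _ λ u →
  box-indicator _ _ _ _ (<?-mono (toℕ u) i'≤i) (<?-mono (toℕ (w ⟨$⟩ʳ u)) j'≤j)

transpose-at-i : ∀ {n} (i j : Fin n) → PC.transpose i j i ≡ j
transpose-at-i i j rewrite dec-true (i Fin.≟ i) refl = refl

transpose-at-j : ∀ {n} (i j : Fin n) → PC.transpose i j j ≡ i
transpose-at-j i j with j Fin.≟ i
... | yes j≡i = j≡i
... | no  _   rewrite dec-true (j Fin.≟ j) refl = refl

transpose-elsewhere : ∀ {n} (i j u : Fin n) → u ≢ i → u ≢ j → PC.transpose i j u ≡ u
transpose-elsewhere i j u u≢i u≢j rewrite dec-false (u Fin.≟ i) u≢i | dec-false (u Fin.≟ j) u≢j = refl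

exchange-cases : (r₁ r₂ a b : Bool) (X Y : ℕ) → (T r₂ → T r₁) →
  ind (r₁ ∧ b) + ind (r₂ ∧ a) + X ≡ ind (r₁ ∧ a) + ind (r₂ ∧ b) + Y →
  X ≡ Y ⊎ suc X ≡ Y ⊎ (T r₁ × T (not r₂) × T a × T (not b))
exchange-cases false true  _     _     _ _ r₂⇒r₁ _  = ⊥-elim (r₂⇒r₁ tt)
exchange-cases false false _     _     _ _ _     eq = inj₁ eq
exchange-cases true  true  true  true  _ _ _     eq = inj₁ (suc-injective (suc-injective eq))
exchange-cases true  true  true  false _ _ _     eq = inj₁ (suc-injective eq)
exchange-cases true  true  false true  _ _ _     eq = inj₁ (suc-injective eq)
exchange-cases true  true  false false _ _ _     eq = inj₁ eq
exchange-cases true  false true  true  _ _ _     eq = inj₁ (suc-injective eq)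
exchange-cases true  false true  false _ _ _     eq = inj₂ (inj₂ (tt , tt , tt , tt))
exchange-cases true  false false true  _ _ _     eq = inj₂ (inj₁ eq)
exchange-cases true  false false false _ _ _     eq = inj₁ eq

-- Right multiplication of x by t = t_{i₁,i₂}, i₁ < i₂, only changes the rank function on
-- the rectangle R = (i₁, i₂] × (x(i₁), x(i₂)] (1-based), where it decreases it by one.
module Transposition {n} (x : Permutation′ n) (i₁ i₂ : Fin n) (i₁<i₂ : toℕ i₁ < toℕ i₂) where

  xt : Permutation′ n
  xt = x ·t[ i₁ , i₂ ]

  InRect : ℕ → ℕ → Set
  InRect l m = (toℕ i₁ < l × l ≤ toℕ i₂) × (toℕ (x ⟨$⟩ʳ i₁) < m × m ≤ toℕ (x ⟨$⟩ʳ i₂))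

  module _ (l m : ℕ) where
    r₁ r₂ a b : Bool
    r₁ = ⌊ toℕ i₁ <? l ⌋
    r₂ = ⌊ toℕ i₂ <? l ⌋
    a  = ⌊ toℕ (x ⟨$⟩ʳ i₁) <? m ⌋
    b  = ⌊ toℕ (x ⟨$⟩ʳ i₂) <? m ⌋

    -- rk_x and rk_xt count the same points except the two exchanged ones.
    exchange-count : ind (r₁ ∧ b) + ind (r₂ ∧ a) + rk x l m ≡ ind (r₁ ∧ a) + ind (r₂ ∧ b) + rk xt l m
    exchange-count = subst₂ (λ c d → ind c + ind d + rk x l m ≡ ind (r₁ ∧ a) + ind (r₂ ∧ b) + rk xt l m)
      (cong (λ u → r₁ ∧ ⌊ toℕ (x ⟨$⟩ʳ u) <? m ⌋) (transpose-at-i i₁ i₂))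
      (cong (λ u → r₂ ∧ ⌊ toℕ (x ⟨$⟩ʳ u) <? m ⌋) (transpose-at-j i₁ i₂))
      (count-update₂ _ _ i₁ i₂ i₁≢i₂ λ u u≢i₁ u≢i₂ →
        cong (λ v → ⌊ toℕ u <? l ⌋ ∧ ⌊ toℕ (x ⟨$⟩ʳ v) <? m ⌋) (sym (transpose-elsewhere i₁ i₂ u u≢i₁ u≢i₂)))
      where
      i₁≢i₂ : i₁ ≢ i₂
      i₁≢i₂ i₁≡i₂ = <-irrefl (cong toℕ i₁≡i₂) i₁<i₂

    rect-rank : InRect l m → rk x l m ≡ suc (rk xt l m)
    rect-rank ((i₁<l , l≤i₂) , (xi₁<m , m≤xi₂)) = inside r₁ r₂ a b
        (fromWitness i₁<l) (fromWitnessFalse (≤⇒≯ l≤i₂)) (fromWitness xi₁<m) (fromWitnessFalse (≤⇒≯ m≤xi₂))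
        exchange-count
      where
      inside : ∀ r₁ r₂ a b → T r₁ → T (not r₂) → T a → T (not b) →
        ind (r₁ ∧ b) + ind (r₂ ∧ a) + rk x l m ≡ ind (r₁ ∧ a) + ind (r₂ ∧ b) + rk xt l m →
        rk x l m ≡ suc (rk xt l m)
      inside true false true false _ _ _ _ eq = eq

    r₂⇒r₁ : T r₂ → T r₁
    r₂⇒r₁ h = fromWitness (<-trans i₁<i₂ (toWitness {a? = toℕ i₂ <? l} h))

    rank-drop⇒rect : rk xt l m ≤ rk x l m → rk x l m ≢ rk xt l m → InRect l m
    rank-drop⇒rect xt≤x x≢xt with exchange-cases r₁ r₂ a b _ _ r₂⇒r₁ exchange-count
    ... | inj₁ x≡xt = ⊥-elim (x≢xt x≡xt)
    ... | inj₂ (inj₁ x<xt) = ⊥-elim (<⇒≱ (≤-reflexive x<xt) xt≤x)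
    ... | inj₂ (inj₂ (t₁ , t₂ , t₃ , t₄)) =
      (toWitness t₁ , ≮⇒≥ (toWitnessFalse t₂)) , (toWitness t₃ , ≮⇒≥ (toWitnessFalse t₄))

maxBelow-≤ : ∀ P j → maxBelow P j ≤ j
maxBelow-≤ P zero = z≤n
maxBelow-≤ P (suc j) with P j
... | true  = n≤1+n j
... | false = m≤n⇒m≤1+n (maxBelow-≤ P j)

maxBelow-spec : ∀ P j → T (P (maxBelow P j)) ⊎ maxBelow P j ≡ 0
maxBelow-spec P zero = inj₂ refl
maxBelow-spec P (suc j) with P j in eq
... | true  = inj₁ (subst T (sym eq) tt)
... | false = maxBelow-spec P j

maxBelow-skip : ∀ P {j} k → j ≤ k → (∀ l → j ≤ l → l < k → ¬ T (P l)) → maxBelow P k ≡ maxBelow P j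
maxBelow-skip P zero z≤n gap = refl
maxBelow-skip P {j} (suc k) j≤1+k gap with j ≤? k
... | no j≰k rewrite ≤-antisym j≤1+k (≰⇒> j≰k) = refl
... | yes j≤k with P k in eq
...   | true  = ⊥-elim (gap k j≤k ≤-refl (subst T (sym eq) tt))
...   | false = maxBelow-skip P k j≤k (λ l j≤l l<k → gap l j≤l (m≤n⇒m≤1+n l<k))

maxBelow-agree : ∀ P (F G : ℕ → ℕ) j → (∀ c → T (P c) → F c ≡ G c) → F 0 ≡ G 0 →
  F (maxBelow P j) ≡ G (maxBelow P j)
maxBelow-agree P F G j on-witness at-zero with maxBelow-spec P j
... | inj₁ found = on-witness _ found
... | inj₂ default = subst (λ c → F c ≡ G c) (sym default) at-zero

firstFrom-≥ : ∀ P k m → k ≤ firstFrom P k m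
firstFrom-≥ P k zero = ≤-refl
firstFrom-≥ P k (suc m) with P k
... | true  = ≤-refl
... | false = ≤-trans (n≤1+n k) (firstFrom-≥ P (suc k) m)

firstFrom-spec : ∀ P k m → T (P (firstFrom P k m)) ⊎ firstFrom P k m ≡ k + m
firstFrom-spec P k zero = inj₂ (sym (+-identityʳ k))
firstFrom-spec P k (suc m) with P k in eq
... | true  = inj₁ (subst T (sym eq) tt)
... | false with firstFrom-spec P (suc k) m
...   | inj₁ found = inj₁ found
...   | inj₂ end   = inj₂ (trans end (sym (+-suc k m)))

firstFrom-skip : ∀ P k m l → k ≤ l → l < firstFrom P k m → ¬ T (P l)
firstFrom-skip P k zero l k≤l l<k _ = <⇒≱ l<k k≤l
firstFrom-skip P k (suc m) l k≤l l<first with P k in eq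
... | true  = λ _ → <⇒≱ l<first k≤l
... | false with k ≟ l
...   | yes refl = subst (λ b → ¬ T b) (sym eq) (λ ())
...   | no k≢l   = firstFrom-skip P (suc k) m l (≤∧≢⇒< k≤l k≢l) l<first

firstFrom-least : ∀ P k m l → k ≤ l → T (P l) → firstFrom P k m ≤ l
firstFrom-least P k m l k≤l Pl with firstFrom P k m ≤? l
... | yes first≤l = first≤l
... | no first≰l  = ⊥-elim (firstFrom-skip P k m l k≤l (≰⇒> first≰l) Pl)

firstFrom-found : ∀ P k m l → k ≤ l → l ≤ k + m → T (P l) → T (P (firstFrom P k m))
firstFrom-found P k m l k≤l l≤k+m Pl with firstFrom-spec P k m
... | inj₁ found = found
... | inj₂ end   = subst (T ∘ P) (≤-antisym (subst (l ≤_) (sym end) l≤k+m) (firstFrom-least P k m l k≤l Pl)) Pl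

-- Bridges between the integer-valued notions of Defs (rk_σ, D) and identities of naturals.
-- The integer constructor +_ clashes with sections of ℕ-addition, so it is opened only here.
module _ where
  open import Data.Integer using (+_; _-_)

  diff-zero⇒≡ : ∀ a b → + a - + b ≡ + 0 → a ≡ b
  diff-zero⇒≡ a b h = ℤ.+-injective (ℤ.i-j≡0⇒i≡j (+ a) (+ b) h)

  ≡⇒diff-zero : ∀ {a b} → a ≡ b → + a - + b ≡ + 0
  ≡⇒diff-zero a≡b = ℤ.i≡j⇒i-j≡0 (cong +_ a≡b)

  diff-< : ∀ a b c d → a + d < c + b → + a - + b ℤ.< + c - + d
  diff-< a b c d a+d<c+b = subst₂ ℤ._<_ (shift (+ a) (+ b) (+ d)) (shift′ (+ c) (+ d) (+ b))
    (ℤ.+-monoˡ-< (ℤ.- (+ (b + d))) (ℤ.+<+ a+d<c+b))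
    where
    shift : ∀ p q r → (p ℤ.+ r) - (q ℤ.+ r) ≡ p - q
    shift = ℤ-Solver.solve-∀
    shift′ : ∀ p q r → (p ℤ.+ r) - (r ℤ.+ q) ≡ p - q
    shift′ = ℤ-Solver.solve-∀

  D≡⇒ : ∀ {n} (w : Permutation′ n) (i j i' j' : ℕ) e → D w (i , j) (i' , j') ≡ + e →
    rk w i j + rk w i' j' ≡ e + (rk w i j' + rk w i' j)
  D≡⇒ w i j i' j' e h = ℤ.+-injective (begin
    + (rk w i j + rk w i' j')
      ≡⟨ split (+ (rk w i j + rk w i' j')) (+ rk w i j') (+ rk w i' j) ⟩
    (((+ rk w i j) ℤ.+ (+ rk w i' j')) - (+ rk w i j') - (+ rk w i' j)) ℤ.+ (+ rk w i j' ℤ.+ + rk w i' j)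
      ≡⟨ cong (ℤ._+ (+ rk w i j' ℤ.+ + rk w i' j)) h ⟩
    + (e + (rk w i j' + rk w i' j)) ∎)
    where
    open ≡-Reasoning
    split : ∀ p q r → p ≡ ((p - q) - r) ℤ.+ (q ℤ.+ r)
    split = ℤ-Solver.solve-∀

  ≡⇒D : ∀ {n} (w : Permutation′ n) (i j i' j' : ℕ) e → rk w i j + rk w i' j' ≡ e + (rk w i j' + rk w i' j) →
    D w (i , j) (i' , j') ≡ + e
  ≡⇒D w i j i' j' e h = begin
    ((+ rk w i j) ℤ.+ (+ rk w i' j')) - (+ rk w i j') - (+ rk w i' j)
      ≡⟨ cong (λ s → (+ s - + rk w i j') - + rk w i' j) h ⟩
    ((+ e) ℤ.+ (+ rk w i j' ℤ.+ + rk w i' j)) - (+ rk w i j') - (+ rk w i' j)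
      ≡⟨ cancel (+ e) (+ rk w i j') (+ rk w i' j) ⟩
    + e ∎
    where
    open ≡-Reasoning
    cancel : ∀ p q r → (p ℤ.+ (q ℤ.+ r) - q) - r ≡ p
    cancel = ℤ-Solver.solve-∀

  InX⇒≡ : ∀ {n} (u v : Permutation′ n) (l m : ℕ) → InX u v (l , m) → rk v l m ≡ rk u l m
  InX⇒≡ u v l m = diff-zero⇒≡ (rk v l m) (rk u l m)

  ≡⇒InX : ∀ {n} (u v : Permutation′ n) (l m : ℕ) → rk v l m ≡ rk u l m → InX u v (l , m)
  ≡⇒InX u v l m = ≡⇒diff-zero

  inXb⇒≡ : ∀ {n} (u v : Permutation′ n) (l m : ℕ) → T (inXb u v (l , m)) → rk v l m ≡ rk u l m
  inXb⇒≡ u v l m h = InX⇒≡ u v l m (toWitness {a? = rkσ u v (l , m) ℤ.≟ + 0} h)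

  ≡⇒inXb : ∀ {n} (u v : Permutation′ n) (l m : ℕ) → rk v l m ≡ rk u l m → T (inXb u v (l , m))
  ≡⇒inXb u v l m e = fromWitness {a? = rkσ u v (l , m) ℤ.≟ + 0} (≡⇒InX u v l m e)

  D-test⇒ : ∀ {n} (w : Permutation′ n) (i j i' j' : ℕ) → T ⌊ D w (i , j) (i' , j') ℤ.≟ + 0 ⌋ →
    rk w i j + rk w i' j' ≡ rk w i j' + rk w i' j
  D-test⇒ w i j i' j' h = D≡⇒ w i j i' j' 0 (toWitness {a? = D w (i , j) (i' , j') ℤ.≟ + 0} h)

  ⇒D-test : ∀ {n} (w : Permutation′ n) (i j i' j' : ℕ) → rk w i j + rk w i' j' ≡ rk w i j' + rk w i' j →
    T ⌊ D w (i , j) (i' , j') ℤ.≟ + 0 ⌋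
  ⇒D-test w i j i' j' e = fromWitness {a? = D w (i , j) (i' , j') ℤ.≟ + 0} (≡⇒D w i j i' j' 0 e)

absorb : ∀ a b c → a + b ≡ c → c ≤ a → b ≡ 0 × a ≡ c
absorb a b c a+b≡c c≤a = b≡0 , trans (sym (+-identityʳ a)) (subst (λ t → a + t ≡ c) b≡0 a+b≡c)
  where
  b≡0 : b ≡ 0
  b≡0 = n≤0⇒n≡0 (+-cancelˡ-≤ a b 0
          (≤-trans (≤-reflexive a+b≡c) (≤-trans c≤a (≤-reflexive (sym (+-identityʳ a))))))

unit-defect : ∀ {n} (w x : Permutation′ n) {i i' k j'} → i' ≤ i → j' ≤ k →
  rk w i' j' ≤ rk x i' j' → rk x i k ≡ suc (rk w i k) → rk x i j' ≡ rk w i j' → rk x i' k ≡ rk w i' k →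
  rk x i k + rk x i' j' ≡ 1 + (rk x i j' + rk x i' k) →
  boxCount w (i' , j') (i , k) ≡ 0 × rk x i' j' ≡ rk w i' j'
unit-defect w x {i} {i'} {k} {j'} i'≤i j'≤k w≤x excess agree-i agree-i' D≡1 =
  absorb (rk x i' j') B (rk w i' j') (+-cancelˡ-≡ (rk w i k) _ _ (begin
    rk w i k + (rk x i' j' + B)   ≡⟨ +-assoc (rk w i k) _ B ⟨
    rk w i k + rk x i' j' + B     ≡⟨ cong (_+ B) defect-in-w ⟩
    rk w i j' + rk w i' k + B     ≡⟨ rk-box w {i} {i'} {k} {j'} i'≤i j'≤k ⟩
    rk w i k + rk w i' j'         ∎)) w≤x
  where
  open ≡-Reasoning
  B : ℕ
  B = boxCount w (i' , j') (i , k)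
  defect-in-w : rk w i k + rk x i' j' ≡ rk w i j' + rk w i' k
  defect-in-w = suc-injective (begin
    suc (rk w i k) + rk x i' j'   ≡⟨ cong (_+ rk x i' j') excess ⟨
    rk x i k + rk x i' j'         ≡⟨ D≡1 ⟩
    suc (rk x i j' + rk x i' k)   ≡⟨ cong₂ (λ a b → suc (a + b)) agree-i agree-i' ⟩
    suc (rk w i j' + rk w i' k)   ∎)

rkσ-drop : ∀ {n} (w x : Permutation′ n) {i i' j j'} → i' ≤ i → j' ≤ j →
  rk x i j' ≡ rk w i j' → rk x i' j' ≡ rk w i' j' →
  rk w i j + rk w i' j' ≡ rk w i j' + rk w i' j →
  1 ≤ boxCount x (i' , j') (i , j) →
  rkσ w x (i' , j) ℤ.< rkσ w x (i , j)
rkσ-drop w x {i} {i'} {j} {j'} i'≤i j'≤j agree-i agree-i' w-flat x-point =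
  diff-< (rk x i' j) (rk w i' j) (rk x i j) (rk w i j) (+-cancelʳ-≤ (rk w i' j') _ _ (begin-strict
    rk x i' j + rk w i j + rk w i' j'     ≡⟨ +-assoc (rk x i' j) _ _ ⟩
    rk x i' j + (rk w i j + rk w i' j')   ≡⟨ cong (rk x i' j +_) w-flat ⟩
    rk x i' j + (rk w i j' + rk w i' j)   ≡⟨ cong (λ r → rk x i' j + (r + rk w i' j)) (sym agree-i) ⟩
    rk x i' j + (rk x i j' + rk w i' j)   ≡⟨ regroup (rk x i' j) (rk x i j') (rk w i' j) ⟩
    rk x i j' + rk x i' j + 0 + rk w i' j <⟨ +-monoˡ-< (rk w i' j) (+-monoʳ-< (rk x i j' + rk x i' j) x-point) ⟩
    rk x i j' + rk x i' j + boxCount x (i' , j') (i , j) + rk w i' j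
                                          ≡⟨ cong (_+ rk w i' j) (rk-box x {i} {i'} {j} {j'} i'≤i j'≤j) ⟩
    rk x i j + rk x i' j' + rk w i' j     ≡⟨ cong (λ r → rk x i j + r + rk w i' j) agree-i' ⟩
    rk x i j + rk w i' j' + rk w i' j     ≡⟨ swap₂₃ (rk x i j) (rk w i' j') (rk w i' j) ⟩
    rk x i j + rk w i' j + rk w i' j'     ∎))
  where
  open ≤-Reasoning
  regroup : ∀ a b c → a + (b + c) ≡ b + a + 0 + c
  regroup = ℕ-Solver.solve-∀
  swap₂₃ : ∀ a b c → a + b + c ≡ a + c + b
  swap₂₃ = ℕ-Solver.solve-∀

-- The setting of the theorem: τ = (w, x) and t = t_{i₁,i₂} ∈ R_τ, i.e. x < xt ≤ w; only the
-- resulting rank inequalities rk_w ≤ rk_xt ≤ rk_x on the grid are used.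
module Setting {n} (w x : Permutation′ n) (i₁ i₂ : Fin n) (i₁<i₂ : toℕ i₁ < toℕ i₂)
  (x≤xt : x ≤B (x ·t[ i₁ , i₂ ])) (xt≤w : (x ·t[ i₁ , i₂ ]) ≤B w) where

  open Transposition x i₁ i₂ i₁<i₂

  module _ {l m} (l≤n : l ≤ n) (m≤n : m ≤ n) where

    -- X_τ ⊆ X_{τ_t}, since rk_w ≤ rk_xt ≤ rk_x.
    X-sandwich : rk x l m ≡ rk w l m → rk xt l m ≡ rk w l m
    X-sandwich x≡w = ≤-antisym (≤-trans (x≤xt l m l≤n m≤n) (≤-reflexive x≡w)) (xt≤w l m l≤n m≤n)

    rect-outside-X : InRect l m → rk x l m ≢ rk w l m
    rect-outside-X rect x≡w =
      1+n≢n (sym (trans (sym x≡w) (trans (rect-rank l m rect) (cong suc (X-sandwich x≡w)))))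

    off-Xt⇒rect : rk x l m ≢ rk xt l m → InRect l m
    off-Xt⇒rect = rank-drop⇒rect l m (x≤xt l m l≤n m≤n)

  module AtPoint (i j : ℕ) (p∉X : InXc w x (i , j)) (q∉X : InXc w x (right w xt (i , j))) where

    k : ℕ
    k = proj₂ (right w xt (i , j))

    i≤n : i ≤ n
    i≤n = proj₁ (proj₁ p∉X)

    k≤n : k ≤ n
    k≤n = proj₂ (proj₁ q∉X)

    j<k : j < k
    j<k = firstFrom-≥ _ (suc j) (n ∸ suc j)

    -- q ∈ X_{τ_t}: it is found by the search, or it is on the last column.
    q∈Xt : rk xt i k ≡ rk w i k
    q∈Xt with firstFrom-spec (λ c → inXb w xt (i , c)) (suc j) (n ∸ suc j)
    ... | inj₁ found = inXb⇒≡ w xt i k found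
    ... | inj₂ end   = subst (λ c → rk xt i c ≡ rk w i c)
                         (sym (trans end (m+[n∸m]≡n (≤-trans j<k k≤n)))) (rk-colₙ xt w i)

    q-rect : InRect i k
    q-rect = off-Xt⇒rect i≤n k≤n (λ x≡xt → proj₂ q∉X (≡⇒InX w x i k (trans x≡xt q∈Xt)))

    q-excess : rk x i k ≡ suc (rk w i k)
    q-excess = trans (rect-rank i k q-rect) (cong suc q∈Xt)

    row-gap : ∀ c → j ≤ c → c < k → ¬ T (inXb w x (i , c))
    row-gap c j≤c c<k c∈X with j ≟ c
    ... | yes refl = proj₂ p∉X (≡⇒InX w x i j (inXb⇒≡ w x i j c∈X))
    ... | no j≢c   = firstFrom-skip (λ c → inXb w xt (i , c)) (suc j) (n ∸ suc j) c (≤∧≢⇒< j≤c j≢c) c<k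
                       (≡⇒inXb w xt i c (X-sandwich i≤n (≤-trans (<⇒≤ c<k) k≤n) (inXb⇒≡ w x i c c∈X)))

    jm : ℕ
    jm = jminus w x (i , j)

    jq≡jm : jminus w x (i , k) ≡ jm
    jq≡jm = maxBelow-skip _ k (<⇒≤ j<k) row-gap

    left-q≡left-p : left w x (right w xt (i , j)) ≡ left w x (i , j)
    left-q≡left-p = cong (i ,_) jq≡jm

    i″ : ℕ
    i″ = proj₁ (pminus w x (i , k))

    i″≤i : i″ ≤ i
    i″≤i = maxBelow-≤ _ i

    jm≤j : jm ≤ j
    jm≤j = maxBelow-≤ _ j

    jm∈X : rk x i jm ≡ rk w i jm
    jm∈X = maxBelow-agree _ (rk x i) (rk w i) j (λ c → inXb⇒≡ w x i c)
             (trans (rk-col₀ x i) (sym (rk-col₀ w i)))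

    i″∈X : rk x i″ k ≡ rk w i″ k
    i″∈X = maxBelow-agree _ (λ c → rk x c k) (λ c → rk w c k) i (λ c → inXb⇒≡ w x c k)
             (trans (rk-row₀ x k) (sym (rk-row₀ w k)))

    i″≤i₁ : i″ ≤ toℕ i₁
    i″≤i₁ = ≮⇒≥ λ i₁<i″ → rect-outside-X (≤-trans i″≤i i≤n) k≤n
      ((i₁<i″ , ≤-trans i″≤i (proj₂ (proj₁ q-rect))) , proj₂ q-rect) i″∈X

    jm≤xi₁ : jm ≤ toℕ (x ⟨$⟩ʳ i₁)
    jm≤xi₁ = ≮⇒≥ λ xi₁<jm → rect-outside-X i≤n (≤-trans jm≤j (≤-trans (<⇒≤ j<k) k≤n))
      (proj₁ q-rect , (xi₁<jm , ≤-trans (≤-trans jm≤j (<⇒≤ j<k)) (proj₂ (proj₂ q-rect)))) jm∈X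

    module UnderRleft (R : Rleft w x (right w xt (i , j))) where

      q-defect : rk x i k + rk x i″ jm ≡ 1 + (rk x i jm + rk x i″ k)
      q-defect = D≡⇒ x i k i″ jm 1 (subst (λ c → D x (i , k) (i″ , c) ≡ ℤ.1ℤ) jq≡jm R)

      -- q^-_τ = (i″, jm) ∈ X_τ, and w has no point in the box (i″, i] × (jm, k] …
      q-box : boxCount w (i″ , jm) (i , k) ≡ 0 × rk x i″ jm ≡ rk w i″ jm
      q-box = unit-defect w x i″≤i (≤-trans jm≤j (<⇒≤ j<k))
        (≤-trans (xt≤w i″ jm i″≤n jm≤n) (x≤xt i″ jm i″≤n jm≤n)) q-excess jm∈X i″∈X q-defect
        where
        i″≤n : i″ ≤ n
        i″≤n = ≤-trans i″≤i i≤n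
        jm≤n : jm ≤ n
        jm≤n = ≤-trans (≤-trans jm≤j (<⇒≤ j<k)) k≤n

      -- … so none in the smaller box (i″, i] × (jm, j] either, and D_w(p, (i″, jm)) = 0.
      p-flat : rk w i j + rk w i″ jm ≡ rk w i jm + rk w i″ j
      p-flat = begin
        rk w i j + rk w i″ jm                              ≡⟨ rk-box w {i} {i″} {j} {jm} i″≤i jm≤j ⟨
        rk w i jm + rk w i″ j + boxCount w (i″ , jm) (i , j) ≡⟨ cong (rk w i jm + rk w i″ j +_) p-box-empty ⟩
        rk w i jm + rk w i″ j + 0                          ≡⟨ +-identityʳ _ ⟩
        rk w i jm + rk w i″ j                              ∎
        where
        open ≡-Reasoning
        p-box-empty : boxCount w (i″ , jm) (i , j) ≡ 0
        p-box-empty = n≤0⇒n≡0 (≤-trans (boxCount-mono w {i} {i″} {j} {jm} {k} (<⇒≤ j<k))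
                                       (≤-reflexive (proj₁ q-box)))

      Candidate : ℕ → Bool
      Candidate c = inXb w x (c , jm) ∧ ⌊ D w (i , j) (c , jm) ℤ.≟ ℤ.0ℤ ⌋

      i″-candidate : T (Candidate i″)
      i″-candidate = Equivalence.from T-∧ (≡⇒inXb w x i″ jm (proj₂ q-box) , ⇒D-test w i j i″ jm p-flat)

      i′ : ℕ
      i′ = proj₁ (up w x (i , j))

      i′≤i″ : i′ ≤ i″
      i′≤i″ = firstFrom-least Candidate 0 i i″ z≤n i″-candidate

      i′-candidate : T (Candidate i′)
      i′-candidate = firstFrom-found Candidate 0 i i″ z≤n i″≤i i″-candidate

      i′≤i₁ : i′ ≤ toℕ i₁
      i′≤i₁ = ≤-trans i′≤i″ i″≤i₁

      not-max : ¬ UpMaximal w x (i , j)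
      not-max up≡p = <-irrefl (cong proj₁ up≡p) (≤-<-trans i′≤i₁ (proj₁ (proj₁ q-rect)))

      module OffXt (p∉Xt : InXc xt x (i , j)) where

        p-rect : InRect i j
        p-rect = off-Xt⇒rect i≤n (proj₂ (proj₁ p∉X)) (λ x≡xt → proj₂ p∉Xt (≡⇒InX xt x i j x≡xt))

        corner-in-box : InHalfOpen n (pminus w x (i , k)) (i , j) (suc (toℕ i₁) , suc (toℕ (x ⟨$⟩ʳ i₁)))
        corner-in-box = (toℕ<n i₁ , toℕ<n (x ⟨$⟩ʳ i₁))
                      , (s≤s i″≤i₁ , s≤s (subst (_≤ toℕ (x ⟨$⟩ʳ i₁)) (sym jq≡jm) jm≤xi₁))
                      , (proj₁ (proj₁ p-rect) , proj₁ (proj₂ p-rect))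

        p-up-drops : Pup w x (i , j)
        p-up-drops = rkσ-drop w x (≤-trans i′≤i″ i″≤i) jm≤j jm∈X
          (inXb⇒≡ w x i′ jm (proj₁ i′-test)) (D-test⇒ w i j i′ jm (proj₂ i′-test))
          (boxCount-pos x i₁ {i} {i′} {j} {jm} i′≤i₁ (proj₁ (proj₁ p-rect)) jm≤xi₁ (proj₁ (proj₂ p-rect)))
          where
          i′-test : T (inXb w x (i′ , jm)) × T ⌊ D w (i , j) (i′ , jm) ℤ.≟ ℤ.0ℤ ⌋
          i′-test = Equivalence.to T-∧ i′-candidate

lemma4p6 : (n : ℕ) (w x : Permutation′ n) → x ≤B w →
    (i j : ℕ) → InXc w x (i , j) →
    (i₁ i₂ : Fin n) → toℕ i₁ < toℕ i₂ →
    x <B (x ·t[ i₁ , i₂ ]) → (x ·t[ i₁ , i₂ ]) ≤B w →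
    InXc w x (right w (x ·t[ i₁ , i₂ ]) (i , j)) →
    (left w x (right w (x ·t[ i₁ , i₂ ]) (i , j)) ≡ left w x (i , j))
    × (Rleft w x (right w (x ·t[ i₁ , i₂ ]) (i , j)) →
        (proj₂ (up w x (i , j)) ≡ j)
        × (proj₁ (up w x (i , j)) < suc (toℕ i₁))
        × (proj₁ (up w x (i , j)) ≤ proj₁ (pminus w x (right w (x ·t[ i₁ , i₂ ]) (i , j))))
        × ¬ UpMaximal w x (i , j)
        × (InXc (x ·t[ i₁ , i₂ ]) x (i , j) →
            InHalfOpen n (pminus w x (right w (x ·t[ i₁ , i₂ ]) (i , j))) (i , j)
              (suc (toℕ i₁) , suc (toℕ (x ⟨$⟩ʳ i₁)))
            × Pup w x (i , j)))
lemma4p6 n w x _ i j p∉X i₁ i₂ i₁<i₂ x<xt xt≤w q∉X =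
  left-q≡left-p , λ R → let open UnderRleft R in
    refl , s≤s i′≤i₁ , i′≤i″ , not-max , λ p∉Xt → let open OffXt p∉Xt in corner-in-box , p-up-drops
  where
  open Setting w x i₁ i₂ i₁<i₂ (proj₁ x<xt) xt≤w
  open AtPoint i j p∉X q∉X
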